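{- Let $G$ and $H$ be connected graphs. Consider all mutual-visibility sets $S$ of $G\odot H$ of the form $S = Q \cup S_{\overline{Q}}$ with $\emptyset \neq Q \subsetneq V(G)$, $\overline{Q} = V(G)\setminus Q$ and $\emptyset \neq S_{\overline{Q}} \subseteq \bigcup_{w\in\overline{Q}} V(H_w)$. Then $\sum_S x^{|S|} = \sum_Q p_Q(x)$, where the sum on the right runs over all non-empty proper subsets $Q\subsetneq V(G)$ that are mutual-visibility sets of $G$, and $$p_Q(x) = \begin{cases} \displaystyle\sum_{\Omega_Q(G)} \left((1+x)^{|\Omega_Q(G)|\,|V(H)|}-1\right)x^{|Q|} & \text{if } Q \text{ is disjoint-visible},\\[8pt] \displaystyle\sum_{\emptyset\neq \mathcal{J}\subseteq \Gamma_Q(G)} (-1)^{|\mathcal{J}|+1}\left((1+x)^{\left|\bigcap_{W\in\mathcal{J}} W\right|\,|V(H)|}-1\right)x^{|Q|} & \text{otherwise},\end{cases}$$ with the sum in the first case over all maximal absolute $c_Q$-visible sets $\Omega_Q(G)$ of $G$.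
   Context: All graphs are finite, simple, undirected and connected. For a graph $G$ and $X \subseteq V(G)$, two vertices $u,v$ are $X$-visible if there exists a shortest $(u,v)$-path $P$ in $G$ with $V(P)\cap X \subseteq \{u,v\}$; a set $Y$ is $X$-visible if every two vertices of $Y$ are $X$-visible. A set $X\subseteq V(G)$ is a mutual-visibility set of $G$ if it is $X$-visible. For $Q\subseteq V(G)$, a set $W\subseteq \overline{Q}=V(G)\setminus Q$ is $c_Q$-visible if $W$ is $Q$-visible and $u,w$ are $Q$-visible for all $u\in Q$, $w\in W$; it is an absolute $c_Q$-visible set if moreover $Q$ is a mutual-visibility set of $G$. A maximal absolute $c_Q$-visible set (one not properly contained in another absolute $c_Q$-visible set) is denoted $\Omega_Q(G)$, and $\Gamma_Q(G)$ is the collection of all maximal absolute $c_Q$-visible sets of $G$. A subset $Q$ is disjoint-visible if, whenever there is more than one maximal absolute $c_Q$-visible set, these sets are pairwise disjoint. The corona $G\odot H$ is obtained from one copy of $G$ and $|V(G)|$ copies of $H$, the copy associated with $v\in V(G)$ being denoted $H_v$, by joining each $v \in V(G)$ to every vertex of $H_v$. -}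

module Defs where

open import Data.Nat as ℕ using (ℕ; zero; suc; _<_; _≤_)
open import Data.Nat.Properties as ℕP using (≮⇒≥; m≤m+n)
open import Data.Fin as F using (Fin; toℕ; fromℕ<; splitAt; join; remQuot; combine; _↑ˡ_; _↑ʳ_)
open import Data.Fin.Properties as FP using (any?; all?; splitAt-join; join-splitAt; toℕ-fromℕ<; toℕ<n)
open import Data.Fin.Subset as Sub using (Subset; inside; outside; _∈_; _∉_; _⊆_; _⊂_; _∩_; _∪_; ∁; ⊤; ∣_∣; Nonempty; Empty)
open import Data.Fin.Subset.Properties as SubP using (_∈?_; _⊆?_; _⊂?_; nonempty?; anySubset?)
open import Data.Bool as B using (Bool; if_then_else_)
open import Data.Vec as Vec using (Vec; []; _∷_; tabulate; lookup)
open import Data.Vec.Properties as VecP using (≡-dec)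
open import Data.List as L using (List; []; _∷_; _++_; map; filter; foldr; length)
open import Data.Integer as ℤ using (ℤ; 0ℤ; 1ℤ; -1ℤ)
open import Data.Product using (Σ; ∃; ∃-syntax; _×_; _,_; proj₁; proj₂)
open import Data.Sum using (_⊎_; inj₁; inj₂)
open import Data.Unit using (tt) renaming (⊤ to Unit)
open import Data.Empty using (⊥-elim)
open import Function using (_∘_)
open import Relation.Nullary using (¬_; Dec; yes; no; does)
open import Relation.Nullary.Decidable as Dec using (_×-dec_; _⊎-dec_; _→-dec_; ¬?)
open import Relation.Binary.PropositionalEquality using (_≡_; _≢_; refl; subst; subst₂; cong) renaming (sym to ≡-sym)

record Graph : Set₁ where
  field
    n      : ℕ
    Adj    : Fin n → Fin n → Set
    adj?   : ∀ u v → Dec (Adj u v)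
    sym    : ∀ {u v} → Adj u v → Adj v u
    irrefl : ∀ {u} → ¬ Adj u u

V : Graph → Set
V G = Fin (Graph.n G)

VSet : Graph → Set
VSet G = Subset (Graph.n G)

-- Walks of length k; a (u,v)-walk of minimal length is a shortest (u,v)-path

module _ (G : Graph) where
  open Graph G

  data Walk : Fin n → Fin n → ℕ → Set where
    nil  : ∀ {u} → Walk u u 0
    cons : ∀ {u w v k} → Adj u w → Walk w v k → Walk u v (suc k)

  OnWalk : (Fin n → Set) → ∀ {u v k} → Walk u v k → Set
  OnWalk P (nil {u})      = P u
  OnWalk P (cons {u} _ q) = P u × OnWalk P q

  NoShorter : Fin n → Fin n → ℕ → Set
  NoShorter u v k = ∀ j → j < k → ¬ Walk u v j

  IsShortestPath : ∀ {u v k} → Walk u v k → Set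
  IsShortestPath {u} {v} {k} _ = NoShorter u v k

  Connected : Set
  Connected = 0 < n × (∀ u v → ∃[ k ] Walk u v k)

  Visible : Subset n → Fin n → Fin n → Set
  Visible X u v = ∃[ k ] Σ (Walk u v k) λ p →
    IsShortestPath p × OnWalk (λ z → z ∈ X → z ≡ u ⊎ z ≡ v) p

  VisibleSet : Subset n → Subset n → Set
  VisibleSet X Y = ∀ u v → u ∈ Y → v ∈ Y → Visible X u v

  MutualVisibilitySet : Subset n → Set
  MutualVisibilitySet X = VisibleSet X X

  CVisible : Subset n → Subset n → Set
  CVisible Q W = W ⊆ ∁ Q × VisibleSet Q W × (∀ u w → u ∈ Q → w ∈ W → Visible Q u w)

  AbsCVisible : Subset n → Subset n → Set
  AbsCVisible Q W = CVisible Q W × MutualVisibilitySet Q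

  MaxAbsCVisible : Subset n → Subset n → Set
  MaxAbsCVisible Q W = AbsCVisible Q W × (∀ W′ → AbsCVisible Q W′ → ¬ (W ⊂ W′))

  DisjointVisible : Subset n → Set
  DisjointVisible Q = ∀ W W′ → MaxAbsCVisible Q W → MaxAbsCVisible Q W′ →
    W ≢ W′ → Empty (W ∩ W′)

-- Corona G ⊙ H.  Vertices: Fin (nG + nG * nH); the first nG are V(G),
-- vertex  nG ↑ʳ combine w h  is the copy of h ∈ V(H) in H_w.

module _ (G H : Graph) where
  private
    module G = Graph G
    module H = Graph H

  -- r ∈ Fin (nG * nH) encodes the pair (base r , fib r)
  base : Fin (G.n ℕ.* H.n) → Fin G.n
  base r = proj₁ (remQuot {G.n} H.n r)

  fib : Fin (G.n ℕ.* H.n) → Fin H.n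
  fib r = proj₂ (remQuot {G.n} H.n r)

  CAdj : Fin G.n ⊎ Fin (G.n ℕ.* H.n) → Fin G.n ⊎ Fin (G.n ℕ.* H.n) → Set
  CAdj (inj₁ g) (inj₁ g′) = G.Adj g g′
  CAdj (inj₁ g) (inj₂ r)  = base r ≡ g
  CAdj (inj₂ r) (inj₁ g)  = base r ≡ g
  CAdj (inj₂ r) (inj₂ r′) = base r ≡ base r′
                            × H.Adj (fib r) (fib r′)

  private
    cadj? : ∀ a b → Dec (CAdj a b)
    cadj? (inj₁ g) (inj₁ g′) = G.adj? g g′
    cadj? (inj₁ g) (inj₂ r)  = base r F.≟ g
    cadj? (inj₂ r) (inj₁ g)  = base r F.≟ g
    cadj? (inj₂ r) (inj₂ r′) = (base r F.≟ base r′)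
                               ×-dec H.adj? _ _

    csym : ∀ {a b} → CAdj a b → CAdj b a
    csym {inj₁ _} {inj₁ _} p = G.sym p
    csym {inj₁ _} {inj₂ _} p = p
    csym {inj₂ _} {inj₁ _} p = p
    csym {inj₂ _} {inj₂ _} (e , p) = ≡-sym e , H.sym p

    cirr : ∀ {a} → ¬ CAdj a a
    cirr {inj₁ _} p = G.irrefl p
    cirr {inj₂ _} (_ , p) = H.irrefl p

  corona : Graph
  corona = record
    { n      = G.n ℕ.+ G.n ℕ.* H.n
    ; Adj    = λ z z′ → CAdj (splitAt G.n z) (splitAt G.n z′)
    ; adj?   = λ z z′ → cadj? (splitAt G.n z) (splitAt G.n z′)
    ; sym    = λ {z} {z′} → csym {splitAt G.n z} {splitAt G.n z′}
    ; irrefl = λ {z} → cirr {splitAt G.n z}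
    }

  gVert : Fin G.n → V corona
  gVert g = g ↑ˡ (G.n ℕ.* H.n)

  hVert : Fin G.n → Fin H.n → V corona
  hVert w h = G.n ↑ʳ combine {G.n} {H.n} w h

  embedG : Subset G.n → VSet corona
  embedG Q = tabulate λ z → pick (splitAt G.n z)
    where
      pick : Fin G.n ⊎ Fin (G.n ℕ.* H.n) → Bool
      pick (inj₁ g) = lookup Q g
      pick (inj₂ _) = outside

  CoronaForm : VSet corona → Set
  CoronaForm S = ∃[ Q ] ∃[ T ]
      Nonempty Q × Q ⊂ Sub.⊤ × Nonempty T
    × (∀ z → z ∈ T → ∃[ w ] ∃[ h ] w ∉ Q × z ≡ hVert w h)
    × S ≡ embedG Q ∪ T

-- Decision procedures (needed only to form the finite sums below)

open import Data.Bool.Properties using () renaming (_≟_ to _≟ᵇ_)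

_≟ˢ_ : ∀ {m} (A B : Subset m) → Dec (A ≡ B)
_≟ˢ_ = ≡-dec _≟ᵇ_

allSubset? : ∀ {m} {P : Subset m → Set} → (∀ S → Dec (P S)) → Dec (∀ S → P S)
allSubset? {P = P} P? with anySubset? (λ S → ¬? (P? S))
... | yes (S , ¬pS) = no λ h → ¬pS (h S)
... | no h = yes λ S → Dec.decidable-stable (P? S) (λ ¬pS → h (S , ¬pS))

empty? : ∀ {m} (A : Subset m) → Dec (Empty A)
empty? A = ¬? (nonempty? A)

module _ (G : Graph) where
  open Graph G

  private
    onWalk-triv : ∀ {u v k} (p : Walk G u v k) → OnWalk G (λ _ → Unit) p
    onWalk-triv nil = tt
    onWalk-triv (cons _ q) = tt , onWalk-triv q

  onWalk? : (P : Fin n → Set) → (∀ z → Dec (P z)) → ∀ k u v →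
            Dec (Σ (Walk G u v k) (OnWalk G P))
  onWalk? P P? zero u v with u F.≟ v
  ... | no u≢v = no λ { (nil , _) → u≢v refl }
  ... | yes refl with P? u
  ...   | yes pu = yes (nil , pu)
  ...   | no ¬pu = no λ { (nil , pu) → ¬pu pu }
  onWalk? P P? (suc k) u v =
    Dec.map′ to from (P? u ×-dec any? (λ w → adj? u w ×-dec onWalk? P P? k w v))
    where
      to : P u × ∃ (λ w → Adj u w × Σ (Walk G w v k) (OnWalk G P)) →
           Σ (Walk G u v (suc k)) (OnWalk G P)
      to (pu , w , a , q , oq) = cons a q , pu , oq
      from : Σ (Walk G u v (suc k)) (OnWalk G P) →
             P u × ∃ (λ w → Adj u w × Σ (Walk G w v k) (OnWalk G P))
      from (cons {w = w} a q , pu , oq) = pu , w , a , q , oq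

  walk? : ∀ k u v → Dec (Walk G u v k)
  walk? k u v = Dec.map′ proj₁ (λ p → p , onWalk-triv p)
                  (onWalk? (λ _ → Unit) (λ _ → yes tt) k u v)

  noShorter? : ∀ u v k → Dec (NoShorter G u v k)
  noShorter? u v k = Dec.map′ to from (all? (λ (i : Fin k) → ¬? (walk? (toℕ i) u v)))
    where
      to : (∀ (i : Fin k) → ¬ Walk G u v (toℕ i)) → NoShorter G u v k
      to h j j<k w = h (fromℕ< j<k) (subst (λ t → Walk G u v t) (≡-sym (toℕ-fromℕ< j<k)) w)
      from : NoShorter G u v k → ∀ (i : Fin k) → ¬ Walk G u v (toℕ i)
      from h i = h (toℕ i) (toℕ<n i)

  visible? : (∀ u v → ∃[ k ] Walk G u v k) → ∀ X u v → Dec (Visible G X u v)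
  visible? conn X u v with conn u v
  ... | K , w = Dec.map′ to from (any? λ (i : Fin (suc K)) → PK? (toℕ i))
    where
      R : Fin n → Set
      R z = z ∈ X → z ≡ u ⊎ z ≡ v
      R? : ∀ z → Dec (R z)
      R? z = (z ∈? X) →-dec ((z F.≟ u) ⊎-dec (z F.≟ v))
      PK : ℕ → Set
      PK k = Σ (Walk G u v k) λ p → IsShortestPath G p × OnWalk G R p
      PK? : ∀ k → Dec (PK k)
      PK? k = Dec.map′ (λ { (ns , p , o) → p , ns , o }) (λ { (p , ns , o) → ns , p , o })
                (noShorter? u v k ×-dec onWalk? R R? k u v)
      to : ∃ (λ (i : Fin (suc K)) → PK (toℕ i)) → Visible G X u v
      to (i , pk) = toℕ i , pk
      from : Visible G X u v → ∃ (λ (i : Fin (suc K)) → PK (toℕ i))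
      from (k , p , ns , o) =
        let k≤K : k ≤ K
            k≤K = ≮⇒≥ (λ K<k → ns K K<k w)
            k<1+K = ℕ.s≤s k≤K
        in fromℕ< k<1+K , subst PK (≡-sym (toℕ-fromℕ< k<1+K)) (p , ns , o)

module _ (G : Graph) (cG : Connected G) where
  open Graph G
  private
    conn = proj₂ cG

  visibleSet? : ∀ X Y → Dec (VisibleSet G X Y)
  visibleSet? X Y = all? λ u → all? λ v →
    (u ∈? Y) →-dec ((v ∈? Y) →-dec visible? G conn X u v)

  mutualVisibilitySet? : ∀ X → Dec (MutualVisibilitySet G X)
  mutualVisibilitySet? X = visibleSet? X X

  absCVisible? : ∀ Q W → Dec (AbsCVisible G Q W)
  absCVisible? Q W =
    ((W ⊆? ∁ Q) ×-dec visibleSet? Q W ×-dec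
      (all? λ u → all? λ w → (u ∈? Q) →-dec ((w ∈? W) →-dec visible? G conn Q u w)))
    ×-dec mutualVisibilitySet? Q

  maxAbsCVisible? : ∀ Q W → Dec (MaxAbsCVisible G Q W)
  maxAbsCVisible? Q W = absCVisible? Q W ×-dec
    allSubset? (λ W′ → absCVisible? Q W′ →-dec ¬? (W ⊂? W′))

  disjointVisible? : ∀ Q → Dec (DisjointVisible G Q)
  disjointVisible? Q = allSubset? λ W → allSubset? λ W′ →
    maxAbsCVisible? Q W →-dec (maxAbsCVisible? Q W′ →-dec
      (¬? (W ≟ˢ W′) →-dec empty? (W ∩ W′)))

module _ (G H : Graph) where
  private
    module G = Graph G
    module H = Graph H
    C = corona G H
    N = G.n ℕ.* H.n

  coronaForm? : ∀ S → Dec (CoronaForm G H S)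
  coronaForm? S = anySubset? λ Q → anySubset? λ T →
    nonempty? Q ×-dec Q ⊂? Sub.⊤ ×-dec nonempty? T
    ×-dec (all? λ z → (z ∈? T) →-dec
             (any? λ w → any? λ h → ¬? (w ∈? Q) ×-dec (z F.≟ hVert G H w h)))
    ×-dec (S ≟ˢ (embedG G H Q ∪ T))

  private
    adjJ : ∀ a b → CAdj G H a b → Graph.Adj C (join G.n N a) (join G.n N b)
    adjJ a b p = subst₂ (CAdj G H) (≡-sym (splitAt-join G.n N a)) (≡-sym (splitAt-join G.n N b)) p

    gJ : Fin G.n → Fin (Graph.n C)
    gJ g = join G.n N (inj₁ g)

    lift : ∀ {g g′ k} → Walk G g g′ k → Walk C (gJ g) (gJ g′) k
    lift nil = nil
    lift (cons {u} {w} a q) = cons (adjJ (inj₁ u) (inj₁ w) a) (lift q)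

    _++W_ : ∀ {u w v k j} → Walk C u w k → Walk C w v j → Walk C u v (k ℕ.+ j)
    nil ++W q = q
    cons a p ++W q = cons a (p ++W q)

    baseOf : Fin G.n ⊎ Fin N → Fin G.n
    baseOf (inj₁ g) = g
    baseOf (inj₂ r) = base G H r

    toBase : ∀ a → ∃[ k ] Walk C (join G.n N a) (gJ (baseOf a)) k
    toBase (inj₁ g) = 0 , nil
    toBase (inj₂ r) = 1 , cons (adjJ (inj₂ r) (inj₁ (base G H r)) refl) nil

    fromBase : ∀ b → ∃[ k ] Walk C (gJ (baseOf b)) (join G.n N b) k
    fromBase (inj₁ g) = 0 , nil
    fromBase (inj₂ r) = 1 , cons (adjJ (inj₁ (base G H r)) (inj₂ r) refl) nil

    walkJ : Connected G → ∀ a b → ∃[ k ] Walk C (join G.n N a) (join G.n N b) k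
    walkJ cG a b with toBase a | proj₂ cG (baseOf a) (baseOf b) | fromBase b
    ... | k₁ , p₁ | k₂ , p₂ | k₃ , p₃ = _ , (p₁ ++W (lift p₂ ++W p₃))

  corona-connected : Connected G → Connected C
  corona-connected cG = ℕP.≤-trans (proj₁ cG) (m≤m+n G.n N) , λ z z′ →
    subst₂ (λ p q → ∃[ k ] Walk C p q k) (join-splitAt G.n N z) (join-splitAt G.n N z′)
      (walkJ cG (splitAt G.n z) (splitAt G.n z′))

allSubsets : ∀ m → List (Subset m)
allSubsets zero    = [] ∷ []
allSubsets (suc m) = map (inside ∷_) (allSubsets m) ++ map (outside ∷_) (allSubsets m)

-- all non-empty sub-collections of a list (each index-subset exactly once)
nonemptySublists : ∀ {A : Set} → List A → List (List A)
nonemptySublists []       = []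
nonemptySublists (x ∷ xs) =
  (x ∷ []) ∷ map (x ∷_) (nonemptySublists xs) ++ nonemptySublists xs

sumℤ : List ℤ → ℤ
sumℤ = foldr ℤ._+_ 0ℤ

⋂ : ∀ {m} → List (Subset m) → Subset m
⋂ = foldr _∩_ Sub.⊤

module _ (G H : Graph) (cG : Connected G) (x : ℤ) where
  private
    nH = Graph.n H

  Γ : Subset (Graph.n G) → List (Subset (Graph.n G))
  Γ Q = filter (maxAbsCVisible? G cG Q) (allSubsets (Graph.n G))

  p : Subset (Graph.n G) → ℤ
  p Q = if does (disjointVisible? G cG Q)
    then sumℤ (map (λ Ω → ((1ℤ ℤ.+ x) ℤ.^ (∣ Ω ∣ ℕ.* nH) ℤ.- 1ℤ) ℤ.* x ℤ.^ ∣ Q ∣) (Γ Q))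
    else sumℤ (map (λ J → -1ℤ ℤ.^ (length J ℕ.+ 1)
                          ℤ.* (((1ℤ ℤ.+ x) ℤ.^ (∣ ⋂ J ∣ ℕ.* nH) ℤ.- 1ℤ) ℤ.* x ℤ.^ ∣ Q ∣))
                   (nonemptySublists (Γ Q)))

  lhsSum : ℤ
  lhsSum = sumℤ (map (λ S → x ℤ.^ ∣ S ∣)
    (filter (λ S → mutualVisibilitySet? (corona G H) (corona-connected G H cG) S
                   ×-dec coronaForm? G H S)
            (allSubsets (Graph.n (corona G H)))))

  rhsSum : ℤ
  rhsSum = sumℤ (map p
    (filter (λ Q → nonempty? Q ×-dec Q ⊂? Sub.⊤ ×-dec mutualVisibilitySet? G cG Q)
            (allSubsets (Graph.n G))))

-- Write S = Q ∪ S_Q̄ and let W ⊆ V(G) be the set of vertices w with S_Q̄ ∩ V(H_w) ≠ ∅.  Project G ⊙ H onto G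
-- by sending H_w to w.  Unless two vertices lie in the same copy of H, a shortest path between them arises
-- from a shortest path of G between their projections by adding one edge at each end that lies in a copy;
-- two vertices of the same copy H_w are adjacent or have the common neighbour w ∉ S.  Hence S is a
-- mutual-visibility set exactly when Q is one of G and W is absolute c_Q-visible, i.e. W lies in some
-- Ω ∈ Γ_Q(G).  For fixed Q, the non-empty S_Q̄ inside the copies H_w with w ∈ U contribute
-- (1 + x)^{|U| |V(H)|} − 1, so inclusion–exclusion over Γ_Q(G) gives p_Q(x); if Q is disjoint-visible, a
-- non-empty W lies in at most one Ω and the alternating sum collapses to the sum over Γ_Q(G).

module Submission where

open import Defs
open import Data.Integer using (ℤ)
open import Relation.Binary.PropositionalEquality using (_≡_)

open import Data.Bool using (if_then_else_; _∨_)
open import Data.Empty using (⊥-elim)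
open import Data.Fin as Fin using (Fin; splitAt; remQuot; combine; _↑ˡ_; _↑ʳ_)
open import Data.Fin.Properties
  using (splitAt-↑ˡ; splitAt-↑ʳ; splitAt⁻¹-↑ˡ; splitAt⁻¹-↑ʳ; ↑ʳ-injective; remQuot-combine; combine-remQuot)
  renaming (any? to anyFin?)
open import Data.Fin.Subset
  using (Subset; inside; outside; _∈_; _∉_; _⊆_; _⊂_; _⊃_; _∪_; ∁; ∣_∣; Nonempty; Empty; ⊤; ⊥)
open import Data.Fin.Subset.Induction using (⊃-wellFounded)
open import Data.Fin.Subset.Properties
  using ( _∈?_; _⊆?_; _⊂?_; nonempty?; anySubset?; ∣⊤∣≡n; ∣⊥∣≡0; ∈⊤; ∉⊥; ⊆-trans; x∈p∩q⁺; x∈p∩q⁻; x∈p∪q⁻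
        ; p⊆p∪q; q⊆p∪q; x∈∁p⇒x∉p; x∉p⇒x∈∁p; Empty-unique; ∪-identityˡ; ∪-identityʳ)
open import Data.Integer using (0ℤ; 1ℤ; -1ℤ; _+_; _*_; _-_; _^_)
open import Data.Integer.Properties
  using (+-identityˡ; +-identityʳ; +-assoc; *-comm; *-zeroʳ; *-identityˡ; *-identityʳ; *-distribˡ-+; ^-distribˡ-+-*)
open import Data.Integer.Tactic.RingSolver using (solve-∀)
open import Data.List using (List; []; _∷_; _++_; map; filter; length)
open import Data.List.Membership.Propositional using (find; lose) renaming (_∈_ to _∈ₗ_)
open import Data.List.Membership.Propositional.Properties
  using (∈-++⁺ˡ; ∈-++⁺ʳ; ∈-map⁺; ∈-map⁻; ∈-filter⁺; ∈-filter⁻)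
open import Data.List.Properties using (map-∘; map-cong)
open import Data.List.Relation.Unary.All as All using (All; []; _∷_; all?)
open import Data.List.Relation.Unary.Any using (Any; here; there; any?)
open import Data.List.Relation.Unary.Unique.Propositional using (Unique; []; _∷_)
import Data.List.Relation.Unary.Unique.Propositional.Properties as Unique
open import Data.Nat as ℕ using (ℕ; zero; suc; _≤_; z≤n; s≤s)
open import Data.Nat.Properties
  using (0≢1+n; ≤-refl; ≤-trans; <-≤-trans; ≤-<-trans; m≤n+m; +-comm; +-monoˡ-≤; +-monoˡ-<; +-monoʳ-<
        ; +-cancelˡ-<; +-cancelʳ-<)
open import Data.Product using (Σ; ∃-syntax; _×_; _,_; proj₁; proj₂; map₂)
open import Data.Sum as Sum using (_⊎_; inj₁; inj₂; [_,_]′; swap)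
open import Data.Unit using (tt) renaming (⊤ to Unit)
open import Data.Vec as Vec
  using ([]; _∷_; here; there; tabulate; lookup; concat; replicate) renaming (_++_ to _++ᵛ_)
open import Data.Vec.Properties
  using ( lookup∘tabulate; tabulate∘lookup; tabulate-cong; lookup-concat; lookup-map; lookup-replicate
        ; []=⇒lookup; lookup⇒[]=; lookup-++ˡ; lookup-++ʳ; lookup-splitAt; zipWith-++; ++-injective)
open import Function using (_∘_; id; const; _⇔_; mk⇔; Equivalence)
open import Induction.WellFounded using (Acc; acc)
open import Relation.Nullary using (¬_; Dec; yes; no; does)
open import Relation.Nullary.Decidable using (_×-dec_; dec-true; decidable-stable)
open import Relation.Binary.PropositionalEquality
  using (_≢_; refl; sym; trans; cong; cong₂; subst; subst₂; module ≡-Reasoning)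

private
  variable
    A B P Q : Set
    m n : ℕ

-- sumℤ ∘ map, so that lhsSum and rhsSum are sums of this form by definition.
∑ : List A → (A → ℤ) → ℤ
∑ xs f = sumℤ (map f xs)

syntax ∑ xs (λ a → e) = ∑[ a ∈ xs ] e

∑-++ : (xs ys : List A) (f : A → ℤ) → ∑ (xs ++ ys) f ≡ ∑ xs f + ∑ ys f
∑-++ [] ys f = sym (+-identityˡ _)
∑-++ (x ∷ xs) ys f = trans (cong (f x +_) (∑-++ xs ys f)) (sym (+-assoc (f x) _ _))

∑-map : (g : A → B) (xs : List A) (f : B → ℤ) → ∑ (map g xs) f ≡ ∑ xs (f ∘ g)
∑-map g xs f = cong sumℤ (sym (map-∘ xs))

∑-cong : (xs : List A) {f g : A → ℤ} → (∀ a → f a ≡ g a) → ∑ xs f ≡ ∑ xs g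
∑-cong xs f≗g = cong sumℤ (map-cong f≗g xs)

∑-zero : (xs : List A) → ∑[ _ ∈ xs ] 0ℤ ≡ 0ℤ
∑-zero [] = refl
∑-zero (x ∷ xs) = trans (+-identityˡ _) (∑-zero xs)

∑-distrib-+ : (xs : List A) (f g : A → ℤ) → ∑[ a ∈ xs ] (f a + g a) ≡ ∑ xs f + ∑ xs g
∑-distrib-+ [] f g = refl
∑-distrib-+ (x ∷ xs) f g =
  trans (cong (f x + g x +_) (∑-distrib-+ xs f g)) (interchange (f x) (g x) _ _)
  where
  interchange : ∀ a b c d → (a + b) + (c + d) ≡ (a + c) + (b + d)
  interchange = solve-∀

*-distribˡ-∑ : (c : ℤ) (xs : List A) (f : A → ℤ) → c * ∑ xs f ≡ ∑[ a ∈ xs ] (c * f a)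
*-distribˡ-∑ c [] f = *-zeroʳ c
*-distribˡ-∑ c (x ∷ xs) f = trans (*-distribˡ-+ c (f x) _) (cong (c * f x +_) (*-distribˡ-∑ c xs f))

∑-comm : (xs : List A) (ys : List B) (f : A → B → ℤ) →
         ∑[ a ∈ xs ] ∑[ b ∈ ys ] f a b ≡ ∑[ b ∈ ys ] ∑[ a ∈ xs ] f a b
∑-comm [] ys f = sym (∑-zero ys)
∑-comm (x ∷ xs) ys f =
  trans (cong (∑ ys (f x) +_) (∑-comm xs ys f)) (sym (∑-distrib-+ ys (f x) _))

when : Dec P → ℤ → ℤ
when P? v = if does P? then v else 0ℤ

𝟙 : Dec P → ℤ
𝟙 P? = when P? 1ℤ

when-cong : (P? : Dec P) (Q? : Dec Q) {v w : ℤ} → P ⇔ Q → (P → v ≡ w) → when P? v ≡ when Q? w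
when-cong (yes p) (yes _) P⇔Q v≡w = v≡w p
when-cong (yes p) (no ¬q) P⇔Q v≡w = ⊥-elim (¬q (Equivalence.to P⇔Q p))
when-cong (no ¬p) (yes q) P⇔Q v≡w = ⊥-elim (¬p (Equivalence.from P⇔Q q))
when-cong (no _)  (no _)  P⇔Q v≡w = refl

when-*ˡ : (P? : Dec P) (c v : ℤ) → when P? (c * v) ≡ c * when P? v
when-*ˡ (yes _) c v = refl
when-*ˡ (no _)  c v = sym (*-zeroʳ c)

when-*-cong : (P? : Dec P) {c u v : ℤ} → (P → u ≡ v) → when P? c * u ≡ when P? c * v
when-*-cong (yes p) {c} u≡v = cong (c *_) (u≡v p)
when-*-cong (no _)      u≡v = refl

when-×-dec : (P? : Dec P) (Q? : Dec Q) (v w : ℤ) → when (P? ×-dec Q?) (v * w) ≡ when P? (v * when Q? w)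
when-×-dec (yes _) (yes _) v w = refl
when-×-dec (yes _) (no _)  v w = sym (*-zeroʳ v)
when-×-dec (no _)  _       v w = refl

when-×-dec-𝟙 : (P? : Dec P) (Q? : Dec Q) (v : ℤ) → when (P? ×-dec Q?) v ≡ when P? v * 𝟙 Q?
when-×-dec-𝟙 (yes _) (yes _) v = sym (*-identityʳ v)
when-×-dec-𝟙 (yes _) (no _)  v = sym (*-zeroʳ v)
when-×-dec-𝟙 (no _)  _       v = refl

𝟙-×-exclusive : (P? : Dec P) (Q? : Dec Q) → (P → ¬ Q) → 𝟙 P? * 𝟙 Q? ≡ 0ℤ
𝟙-×-exclusive (yes p) (yes q) P→¬Q = ⊥-elim (P→¬Q p q)
𝟙-×-exclusive (yes _) (no _)  P→¬Q = refl
𝟙-×-exclusive (no _)  _       P→¬Q = refl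

if-does : {C : Set} (P? : Dec P) {u v w : C} → (P → u ≡ w) → (¬ P → v ≡ w) → (if does P? then u else v) ≡ w
if-does (yes p) u≡w _ = u≡w p
if-does (no ¬p) _ v≡w = v≡w ¬p

∑-when : (P? : Dec P) (xs : List A) (c : ℤ) (f : A → ℤ) →
         ∑[ a ∈ xs ] when P? (c * f a) ≡ when P? (c * ∑ xs f)
∑-when (yes _) xs c f = sym (*-distribˡ-∑ c xs f)
∑-when (no _)  xs c f = ∑-zero xs

∑-filter : {R : A → Set} (R? : ∀ a → Dec (R a)) (xs : List A) (f : A → ℤ) →
           ∑ (filter R? xs) f ≡ ∑[ a ∈ xs ] when (R? a) (f a)
∑-filter R? [] f = refl
∑-filter R? (x ∷ xs) f with R? x
... | yes _ = cong (f x +_) (∑-filter R? xs f)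
... | no _  = trans (∑-filter R? xs f) (sym (+-identityˡ _))

-- Inclusion–exclusion

sign : List A → ℤ
sign J = -1ℤ ^ (length J ℕ.+ 1)

module _ {X : Set} {R : X → Set} (R? : ∀ a → Dec (R a)) where

  𝟙-all-∷ : ∀ a J → 𝟙 (all? R? (a ∷ J)) ≡ 𝟙 (R? a) * 𝟙 (all? R? J)
  𝟙-all-∷ a J with R? a | all? R? J
  ... | yes _ | yes _ = refl
  ... | yes _ | no _  = refl
  ... | no _  | yes _ = refl
  ... | no _  | no _  = refl

  𝟙-any-∷ : ∀ a L → 𝟙 (any? R? (a ∷ L)) ≡ 𝟙 (R? a) + 𝟙 (any? R? L) - 𝟙 (R? a) * 𝟙 (any? R? L)
  𝟙-any-∷ a L with R? a | any? R? L
  ... | yes _ | yes _ = refl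
  ... | yes _ | no _  = refl
  ... | no _  | yes _ = refl
  ... | no _  | no _  = refl

  𝟙-any-inclusion–exclusion : ∀ L → 𝟙 (any? R? L) ≡ ∑[ J ∈ nonemptySublists L ] (sign J * 𝟙 (all? R? J))
  𝟙-any-inclusion–exclusion [] = refl
  𝟙-any-inclusion–exclusion (a ∷ L) = begin
    𝟙 (any? R? (a ∷ L))                                    ≡⟨ 𝟙-any-∷ a L ⟩
    i + 𝟙 (any? R? L) - i * 𝟙 (any? R? L)                  ≡⟨ cong (λ s → i + s - i * s) IH ⟩
    i + S - i * S                                          ≡⟨ regroup i S ⟩
    i + ((-1ℤ * i) * S + S)                                ≡⟨ cong₂ (λ u v → u + (v + S)) (sym singleton) extend ⟩
    t (a ∷ []) + (∑ (map (a ∷_) (nonemptySublists L)) t + S)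
      ≡⟨ cong (t (a ∷ []) +_) (sym (∑-++ (map (a ∷_) (nonemptySublists L)) (nonemptySublists L) t)) ⟩
    ∑ (nonemptySublists (a ∷ L)) t                         ∎
    where
    open ≡-Reasoning
    t : List X → ℤ
    t J = sign J * 𝟙 (all? R? J)
    i = 𝟙 (R? a)
    S = ∑ (nonemptySublists L) t
    IH = 𝟙-any-inclusion–exclusion L
    regroup : ∀ i S → i + S - i * S ≡ i + ((-1ℤ * i) * S + S)
    regroup = solve-∀
    singleton : t (a ∷ []) ≡ i
    singleton = trans (*-identityˡ _) (trans (𝟙-all-∷ a []) (*-identityʳ i))
    swap-sign : ∀ s i e → (-1ℤ * s) * (i * e) ≡ (-1ℤ * i) * (s * e)
    swap-sign = solve-∀
    prepend-a : ∀ J → (-1ℤ * i) * t J ≡ t (a ∷ J)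
    prepend-a J = trans (sym (swap-sign (sign J) i (𝟙 (all? R? J)))) (cong (-1ℤ * sign J *_) (sym (𝟙-all-∷ a J)))
    extend : (-1ℤ * i) * S ≡ ∑ (map (a ∷_) (nonemptySublists L)) t
    extend = begin
      (-1ℤ * i) * S                                   ≡⟨ *-distribˡ-∑ (-1ℤ * i) (nonemptySublists L) t ⟩
      ∑[ J ∈ nonemptySublists L ] ((-1ℤ * i) * t J)   ≡⟨ ∑-cong (nonemptySublists L) prepend-a ⟩
      ∑[ J ∈ nonemptySublists L ] t (a ∷ J)           ≡⟨ sym (∑-map (a ∷_) (nonemptySublists L) t) ⟩
      ∑ (map (a ∷_) (nonemptySublists L)) t           ∎

  𝟙-any-atMostOne : ∀ L → Unique L → (∀ {a b} → a ∈ₗ L → b ∈ₗ L → R a → R b → a ≡ b) →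
                    𝟙 (any? R? L) ≡ ∑[ a ∈ L ] 𝟙 (R? a)
  𝟙-any-atMostOne [] _ _ = refl
  𝟙-any-atMostOne (a ∷ L) (a∉L ∷ unique) atMostOne = begin
    𝟙 (any? R? (a ∷ L))     ≡⟨ 𝟙-any-∷ a L ⟩
    i + s - i * s           ≡⟨ cong (i + s -_) (𝟙-×-exclusive (R? a) (any? R? L) onlyHead) ⟩
    i + s - 0ℤ              ≡⟨ +-identityʳ (i + s) ⟩
    i + s                   ≡⟨ cong (i +_) (𝟙-any-atMostOne L unique (λ a∈ b∈ → atMostOne (there a∈) (there b∈))) ⟩
    ∑[ b ∈ a ∷ L ] 𝟙 (R? b) ∎
    where
    open ≡-Reasoning
    i = 𝟙 (R? a)
    s = 𝟙 (any? R? L)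
    onlyHead : R a → ¬ Any R L
    onlyHead ra anyR with find anyR
    ... | b , b∈L , rb = All.lookup a∉L b∈L (atMostOne (here refl) (there b∈L) ra rb)

∈-allSubsets : (S : Subset m) → S ∈ₗ allSubsets m
∈-allSubsets [] = here refl
∈-allSubsets {suc m} (inside ∷ S) = ∈-++⁺ˡ (∈-map⁺ (inside ∷_) (∈-allSubsets S))
∈-allSubsets {suc m} (outside ∷ S) = ∈-++⁺ʳ _ (∈-map⁺ (outside ∷_) (∈-allSubsets S))

allSubsets-unique : ∀ m → Unique (allSubsets m)
allSubsets-unique zero = [] ∷ []
allSubsets-unique (suc m) =
  Unique.++⁺ (Unique.map⁺ ∷-injectiveʳ (allSubsets-unique m))
             (Unique.map⁺ ∷-injectiveʳ (allSubsets-unique m)) heads-differ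
  where
  ∷-injectiveʳ : ∀ {b} {S T : Subset m} → b ∷ S ≡ b ∷ T → S ≡ T
  ∷-injectiveʳ refl = refl
  heads-differ : ∀ {S} → ¬ (S ∈ₗ map (inside ∷_) (allSubsets m) × S ∈ₗ map (outside ∷_) (allSubsets m))
  heads-differ (S∈ , S∈′) with ∈-map⁻ (inside ∷_) S∈ | ∈-map⁻ (outside ∷_) S∈′
  ... | _ , _ , refl | _ , _ , ()

∑-allSubsets-suc : (f : Subset (suc m) → ℤ) →
  ∑ (allSubsets (suc m)) f ≡ ∑[ S ∈ allSubsets m ] f (inside ∷ S) + ∑[ S ∈ allSubsets m ] f (outside ∷ S)
∑-allSubsets-suc {m} f =
  trans (∑-++ (map (inside ∷_) (allSubsets m)) _ f)
        (cong₂ _+_ (∑-map (inside ∷_) (allSubsets m) f) (∑-map (outside ∷_) (allSubsets m) f))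

∑-allSubsets-++ : ∀ m n (f : Subset (m ℕ.+ n) → ℤ) →
  ∑ (allSubsets (m ℕ.+ n)) f ≡ ∑[ A ∈ allSubsets m ] ∑[ B ∈ allSubsets n ] f (A ++ᵛ B)
∑-allSubsets-++ zero n f = sym (+-identityʳ _)
∑-allSubsets-++ (suc m) n f = begin
  ∑ (allSubsets (suc m ℕ.+ n)) f                                                ≡⟨ ∑-allSubsets-suc f ⟩
  ∑ (allSubsets (m ℕ.+ n)) (f ∘ (inside ∷_)) + ∑ (allSubsets (m ℕ.+ n)) (f ∘ (outside ∷_))
    ≡⟨ cong₂ _+_ (∑-allSubsets-++ m n (f ∘ (inside ∷_))) (∑-allSubsets-++ m n (f ∘ (outside ∷_))) ⟩
  ∑[ A ∈ allSubsets m ] g (inside ∷ A) + ∑[ A ∈ allSubsets m ] g (outside ∷ A)  ≡⟨ sym (∑-allSubsets-suc g) ⟩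
  ∑ (allSubsets (suc m)) g                                                      ∎
  where
  open ≡-Reasoning
  g : Subset (suc m) → ℤ
  g A = ∑[ B ∈ allSubsets n ] f (A ++ᵛ B)

∣++∣ : (A : Subset m) (B : Subset n) → ∣ A ++ᵛ B ∣ ≡ ∣ A ∣ ℕ.+ ∣ B ∣
∣++∣ [] B = refl
∣++∣ (inside ∷ A) B = cong suc (∣++∣ A B)
∣++∣ (outside ∷ A) B = ∣++∣ A B

when-nonempty-outside : (B : Subset m) (Q? : Dec Q) (v : ℤ) →
                        when (nonempty? (outside ∷ B) ×-dec Q?) v ≡ when (nonempty? B ×-dec Q?) v
when-nonempty-outside B Q? v = when-cong (nonempty? (outside ∷ B) ×-dec Q?) (nonempty? B ×-dec Q?)
  (mk⇔ (λ { ((Fin.suc i , there i∈B) , q) → (i , i∈B) , q }) (λ { ((i , i∈B) , q) → (Fin.suc i , there i∈B) , q }))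
  (λ _ → refl)

-- In the inductive steps the tests on inside ∷ B and outside ∷ B reduce to tests on B by computation.
module PowerSums (x : ℤ) where

  ∑-powers-⊆ : (R : Subset m) → ∑[ B ∈ allSubsets m ] when (B ⊆? R) (x ^ ∣ B ∣) ≡ (1ℤ + x) ^ ∣ R ∣
  ∑-powers-⊆-shifted : (R : Subset m) → ∑[ B ∈ allSubsets m ] when (B ⊆? R) (x * x ^ ∣ B ∣) ≡ x * (1ℤ + x) ^ ∣ R ∣

  ∑-powers-⊆ [] = refl
  ∑-powers-⊆ {suc m} (inside ∷ R) = begin
    ∑[ B ∈ allSubsets (suc m) ] when (B ⊆? inside ∷ R) (x ^ ∣ B ∣)                      ≡⟨ ∑-allSubsets-suc {m} _ ⟩
    ∑[ B ∈ allSubsets m ] when (B ⊆? R) (x * x ^ ∣ B ∣) + ∑[ B ∈ allSubsets m ] when (B ⊆? R) (x ^ ∣ B ∣)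
      ≡⟨ cong₂ _+_ (∑-powers-⊆-shifted R) (∑-powers-⊆ R) ⟩
    x * (1ℤ + x) ^ ∣ R ∣ + (1ℤ + x) ^ ∣ R ∣                                              ≡⟨ factor x _ ⟩
    (1ℤ + x) ^ ∣ inside ∷ R ∣                                                            ∎
    where
    open ≡-Reasoning
    factor : ∀ x p → x * p + p ≡ (1ℤ + x) * p
    factor = solve-∀
  ∑-powers-⊆ {suc m} (outside ∷ R) = begin
    ∑[ B ∈ allSubsets (suc m) ] when (B ⊆? outside ∷ R) (x ^ ∣ B ∣)                     ≡⟨ ∑-allSubsets-suc {m} _ ⟩
    ∑[ B ∈ allSubsets m ] 0ℤ + ∑[ B ∈ allSubsets m ] when (B ⊆? R) (x ^ ∣ B ∣)
      ≡⟨ cong₂ _+_ (∑-zero (allSubsets m)) (∑-powers-⊆ R) ⟩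
    0ℤ + (1ℤ + x) ^ ∣ R ∣                                                                ≡⟨ +-identityˡ _ ⟩
    (1ℤ + x) ^ ∣ outside ∷ R ∣                                                           ∎
    where open ≡-Reasoning

  ∑-powers-⊆-shifted {m} R = begin
    ∑[ B ∈ allSubsets m ] when (B ⊆? R) (x * x ^ ∣ B ∣)    ≡⟨ ∑-cong (allSubsets m) (λ B → when-*ˡ (B ⊆? R) x _) ⟩
    ∑[ B ∈ allSubsets m ] (x * when (B ⊆? R) (x ^ ∣ B ∣))   ≡⟨ sym (*-distribˡ-∑ x (allSubsets m) _) ⟩
    x * ∑[ B ∈ allSubsets m ] when (B ⊆? R) (x ^ ∣ B ∣)     ≡⟨ cong (x *_) (∑-powers-⊆ R) ⟩
    x * (1ℤ + x) ^ ∣ R ∣                                    ∎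
    where open ≡-Reasoning

  ∑-powers-nonempty-⊆ : (R : Subset m) →
    ∑[ B ∈ allSubsets m ] when (nonempty? B ×-dec B ⊆? R) (x ^ ∣ B ∣) ≡ (1ℤ + x) ^ ∣ R ∣ - 1ℤ
  ∑-powers-nonempty-⊆-outside : (R : Subset m) →
    ∑[ B ∈ allSubsets m ] when (nonempty? (outside ∷ B) ×-dec B ⊆? R) (x ^ ∣ B ∣) ≡ (1ℤ + x) ^ ∣ R ∣ - 1ℤ

  ∑-powers-nonempty-⊆ [] = refl
  ∑-powers-nonempty-⊆ {suc m} (inside ∷ R) = begin
    ∑[ B ∈ allSubsets (suc m) ] when (nonempty? B ×-dec B ⊆? inside ∷ R) (x ^ ∣ B ∣)     ≡⟨ ∑-allSubsets-suc {m} _ ⟩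
    ∑[ B ∈ allSubsets m ] when (B ⊆? R) (x * x ^ ∣ B ∣) +
    ∑[ B ∈ allSubsets m ] when (nonempty? (outside ∷ B) ×-dec B ⊆? R) (x ^ ∣ B ∣)
      ≡⟨ cong₂ _+_ (∑-powers-⊆-shifted R) (∑-powers-nonempty-⊆-outside R) ⟩
    x * (1ℤ + x) ^ ∣ R ∣ + ((1ℤ + x) ^ ∣ R ∣ - 1ℤ)                                       ≡⟨ factor x _ ⟩
    (1ℤ + x) ^ ∣ inside ∷ R ∣ - 1ℤ                                                      ∎
    where
    open ≡-Reasoning
    factor : ∀ x p → x * p + (p - 1ℤ) ≡ (1ℤ + x) * p - 1ℤ
    factor = solve-∀
  ∑-powers-nonempty-⊆ {suc m} (outside ∷ R) = begin
    ∑[ B ∈ allSubsets (suc m) ] when (nonempty? B ×-dec B ⊆? outside ∷ R) (x ^ ∣ B ∣)    ≡⟨ ∑-allSubsets-suc {m} _ ⟩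
    ∑[ B ∈ allSubsets m ] 0ℤ +
    ∑[ B ∈ allSubsets m ] when (nonempty? (outside ∷ B) ×-dec B ⊆? R) (x ^ ∣ B ∣)
      ≡⟨ cong₂ _+_ (∑-zero (allSubsets m)) (∑-powers-nonempty-⊆-outside R) ⟩
    0ℤ + ((1ℤ + x) ^ ∣ R ∣ - 1ℤ)                                                        ≡⟨ +-identityˡ _ ⟩
    (1ℤ + x) ^ ∣ outside ∷ R ∣ - 1ℤ                                                     ∎
    where open ≡-Reasoning

  ∑-powers-nonempty-⊆-outside {m} R =
    trans (∑-cong (allSubsets m) (λ B → when-nonempty-outside B (B ⊆? R) _)) (∑-powers-nonempty-⊆ R)

lookup⇒∈ : {i : Fin n} {p : Subset n} → lookup p i ≡ inside → i ∈ p
lookup⇒∈ {i = i} {p} = lookup⇒[]= i p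

image : (Fin m → Fin n) → Subset m → Subset n
image f B = tabulate λ w → does (anyFin? λ r → (r ∈? B) ×-dec (f r Fin.≟ w))

preimage : (Fin m → Fin n) → Subset n → Subset m
preimage f U = tabulate (lookup U ∘ f)

module _ (f : Fin m → Fin n) where

  ∈-image⁺ : {B : Subset m} {r : Fin m} → r ∈ B → f r ∈ image f B
  ∈-image⁺ {B} {r} r∈B = lookup⇒∈ (trans (lookup∘tabulate _ (f r)) (dec-true (anyFin? _) (r , r∈B , refl)))

  ∈-image⁻ : {B : Subset m} {w : Fin n} → w ∈ image f B → ∃[ r ] r ∈ B × f r ≡ w
  ∈-image⁻ {B} {w} w∈ with anyFin? (λ r → (r ∈? B) ×-dec (f r Fin.≟ w))
                         | trans (sym (lookup∘tabulate _ w)) ([]=⇒lookup w∈)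
  ... | yes found | _  = found
  ... | no _      | ()

  ∈-preimage⁺ : {U : Subset n} {r : Fin m} → f r ∈ U → r ∈ preimage f U
  ∈-preimage⁺ {U} {r} fr∈U = lookup⇒∈ (trans (lookup∘tabulate (lookup U ∘ f) r) ([]=⇒lookup fr∈U))

  ∈-preimage⁻ : {U : Subset n} {r : Fin m} → r ∈ preimage f U → f r ∈ U
  ∈-preimage⁻ {U} {r} r∈ = lookup⇒∈ (trans (sym (lookup∘tabulate (lookup U ∘ f) r)) ([]=⇒lookup r∈))

  image⊆⇒⊆preimage : {B : Subset m} {U : Subset n} → image f B ⊆ U → B ⊆ preimage f U
  image⊆⇒⊆preimage fB⊆U r∈B = ∈-preimage⁺ (fB⊆U (∈-image⁺ r∈B))

  ⊆preimage⇒image⊆ : {B : Subset m} {U : Subset n} → B ⊆ preimage f U → image f B ⊆ U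
  ⊆preimage⇒image⊆ B⊆ w∈ with ∈-image⁻ w∈
  ... | r , r∈B , refl = ∈-preimage⁻ (B⊆ r∈B)

∣preimage-remQuot∣ : ∀ k (U : Subset m) → ∣ preimage (proj₁ ∘ remQuot {m} k) U ∣ ≡ ∣ U ∣ ℕ.* k
∣preimage-remQuot∣ {m} k U = trans (cong ∣_∣ preimage≡concat) (∣concat-replicate∣ U)
  where
  blocks : Subset (m ℕ.* k)
  blocks = concat (Vec.map (replicate k) U)
  preimage≡concat : preimage (proj₁ ∘ remQuot {m} k) U ≡ blocks
  preimage≡concat = trans (tabulate-cong entry) (tabulate∘lookup blocks)
    where
    entry : ∀ i → lookup U (proj₁ (remQuot {m} k i)) ≡ lookup blocks i
    entry i = begin
      lookup U a                                     ≡⟨ sym (lookup-replicate b _) ⟩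
      lookup (replicate k (lookup U a)) b            ≡⟨ cong (λ v → lookup v b) (sym (lookup-map a (replicate k) U)) ⟩
      lookup (lookup (Vec.map (replicate k) U) a) b  ≡⟨ sym (lookup-concat (Vec.map (replicate k) U) a b) ⟩
      lookup blocks (combine a b)                    ≡⟨ cong (lookup blocks) (combine-remQuot {m} k i) ⟩
      lookup blocks i                                ∎
      where
      open ≡-Reasoning
      a = proj₁ (remQuot {m} k i)
      b = proj₂ (remQuot {m} k i)
  ∣concat-replicate∣ : ∀ {m} (U : Subset m) → ∣ concat (Vec.map (replicate k) U) ∣ ≡ ∣ U ∣ ℕ.* k
  ∣concat-replicate∣ [] = refl
  ∣concat-replicate∣ (inside ∷ U) =
    trans (∣++∣ (replicate k inside) _) (cong₂ ℕ._+_ (∣⊤∣≡n k) (∣concat-replicate∣ U))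
  ∣concat-replicate∣ (outside ∷ U) =
    trans (∣++∣ (replicate k outside) _) (cong₂ ℕ._+_ (∣⊥∣≡0 k) (∣concat-replicate∣ U))

⊆-⋂⁺ : {W : Subset n} (J : List (Subset n)) → All (W ⊆_) J → W ⊆ ⋂ J
⊆-⋂⁺ [] [] _ = ∈⊤
⊆-⋂⁺ (Ω ∷ J) (W⊆Ω ∷ W⊆J) w∈W = x∈p∩q⁺ (W⊆Ω w∈W , ⊆-⋂⁺ J W⊆J w∈W)

⊆-⋂⁻ : {W : Subset n} (J : List (Subset n)) → W ⊆ ⋂ J → All (W ⊆_) J
⊆-⋂⁻ [] _ = []
⊆-⋂⁻ (Ω ∷ J) W⊆ = (proj₁ ∘ x∈p∩q⁻ Ω (⋂ J) ∘ W⊆) ∷ ⊆-⋂⁻ J (proj₂ ∘ x∈p∩q⁻ Ω (⋂ J) ∘ W⊆)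

module _ {S : Subset n → Set} (S? : ∀ W → Dec (S W)) where

  extend-to-maximal : {W : Subset n} → S W → ∃[ Ω ] (S Ω × (∀ W′ → S W′ → ¬ Ω ⊂ W′)) × W ⊆ Ω
  extend-to-maximal {W} = go W (⊃-wellFounded W)
    where
    go : ∀ W → Acc _⊃_ W → S W → ∃[ Ω ] (S Ω × (∀ W′ → S W′ → ¬ Ω ⊂ W′)) × W ⊆ Ω
    go W (acc larger) sW with anySubset? (λ W′ → S? W′ ×-dec W ⊂? W′)
    ... | no ∄larger = W , (sW , λ W′ sW′ W⊂W′ → ∄larger (W′ , sW′ , W⊂W′)) , id
    ... | yes (W′ , sW′ , W⊂W′) with go W′ (larger W⊂W′) sW′
    ...   | Ω , maxΩ , W′⊆Ω = Ω , maxΩ , ⊆-trans (proj₁ W⊂W′) W′⊆Ω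

WalkIn : (G : Graph) → (V G → Set) → V G → V G → ℕ → Set
WalkIn G S u v k = Σ (Walk G u v k) (OnWalk G S)

module _ {G : Graph} where
  open Graph G using (Adj; adj?)

  private
    variable
      u v w : V G
      j k : ℕ
      S T : V G → Set

  _++ᵂ_ : Walk G u w k → Walk G w v j → Walk G u v (k ℕ.+ j)
  nil ++ᵂ q = q
  cons e p ++ᵂ q = cons e (p ++ᵂ q)

  OnWalk-++ : (p : Walk G u w k) (q : Walk G w v j) → OnWalk G S p → OnWalk G S q → OnWalk G S (p ++ᵂ q)
  OnWalk-++ nil q _ oq = oq
  OnWalk-++ (cons e p) q (su , op) oq = su , OnWalk-++ p q op oq

  _++ᴾ_ : WalkIn G S u w k → WalkIn G S w v j → WalkIn G S u v (k ℕ.+ j)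
  (p , op) ++ᴾ (q , oq) = p ++ᵂ q , OnWalk-++ p q op oq

  OnWalk-map : (∀ z → S z → T z) → (p : Walk G u v k) → OnWalk G S p → OnWalk G T p
  OnWalk-map S⇒T (nil {u}) su = S⇒T u su
  OnWalk-map S⇒T (cons {u} e p) (su , op) = S⇒T u su , OnWalk-map S⇒T p op

  OnWalk-first : (p : Walk G u v k) → OnWalk G S p → S u
  OnWalk-first nil su = su
  OnWalk-first (cons e p) (su , _) = su

  OnWalk-last : (p : Walk G u v k) → OnWalk G S p → S v
  OnWalk-last nil sv = sv
  OnWalk-last (cons e p) (_ , op) = OnWalk-last p op

  OnWalk-Unit : (p : Walk G u v k) → OnWalk G (λ _ → Unit) p
  OnWalk-Unit nil = tt
  OnWalk-Unit (cons e p) = tt , OnWalk-Unit p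

  reverse : WalkIn G S u v k → WalkIn G S v u k
  reverse (nil , su) = nil , su
  reverse {k = suc k} (cons e p , su , op) =
    subst (WalkIn G _ _ _) (+-comm k 1) (reverse (p , op) ++ᴾ (cons (Graph.sym G e) nil , OnWalk-first p op , su))

  walk-zero : Walk G u v 0 → u ≡ v
  walk-zero nil = refl

  walk-one : Walk G u v 1 → Adj u v
  walk-one (cons e nil) = e

  visible-refl : (X : VSet G) (u : V G) → Visible G X u u
  visible-refl X u = 0 , nil , (λ _ ()) , λ _ → inj₁ refl

  visible-sym : {X : VSet G} → Visible G X u v → Visible G X v u
  visible-sym (k , p , shortest , op) =
    let (p′ , op′) = reverse (p , OnWalk-map (λ _ between z∈X → swap (between z∈X)) p op)
    in k , p′ , (λ j j<k q → shortest j j<k (proj₁ (reverse (q , OnWalk-Unit q)))) , op′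

  visible-via-common-neighbour : {X : VSet G} {c : V G} → u ≢ v → c ∉ X → Adj u c → Adj c v → Visible G X u v
  visible-via-common-neighbour {u} {v} u≢v c∉X uc cv with adj? u v
  ... | yes uv = 1 , cons uv nil , shortest , (λ _ → inj₁ refl) , (λ _ → inj₂ refl)
    where
    shortest : NoShorter G u v 1
    shortest zero _ q = u≢v (walk-zero q)
    shortest (suc _) (s≤s ()) _
  ... | no ¬uv = 2 , cons uc (cons cv nil) , shortest , (λ _ → inj₁ refl) , (⊥-elim ∘ c∉X) , (λ _ → inj₂ refl)
    where
    shortest : NoShorter G u v 2
    shortest zero _ q = u≢v (walk-zero q)
    shortest (suc zero) _ q = ¬uv (walk-one q)
    shortest (suc (suc _)) (s≤s (s≤s ())) _

module _ {G : Graph} {Q W : VSet G} where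

  absCVisible-⊆ : {W′ : VSet G} → W′ ⊆ W → AbsCVisible G Q W → AbsCVisible G Q W′
  absCVisible-⊆ W′⊆W ((W⊆∁Q , visW , visQW) , mvQ) =
    ( W⊆∁Q ∘ W′⊆W
    , (λ u v u∈ v∈ → visW u v (W′⊆W u∈) (W′⊆W v∈))
    , (λ u w u∈ w∈ → visQW u w u∈ (W′⊆W w∈)) ) , mvQ

  absCVisible⇒visibleSet-∪ : AbsCVisible G Q W → VisibleSet G Q (Q ∪ W)
  absCVisible⇒visibleSet-∪ ((_ , visW , visQW) , mvQ) u v u∈ v∈ with x∈p∪q⁻ Q W u∈ | x∈p∪q⁻ Q W v∈
  ... | inj₁ u∈Q | inj₁ v∈Q = mvQ u v u∈Q v∈Q
  ... | inj₁ u∈Q | inj₂ v∈W = visQW u v u∈Q v∈W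
  ... | inj₂ u∈W | inj₁ v∈Q = visible-sym (visQW v u v∈Q u∈W)
  ... | inj₂ u∈W | inj₂ v∈W = visW u v u∈W v∈W

-- The corona G ⊙ H

module CoronaGeometry (G H : Graph) where
  private
    module G = Graph G
    module H = Graph H
    N = G.n ℕ.* H.n
    C = corona G H
    module C = Graph C
    variable
      a b c : V C
      j k : ℕ

  copyVert : Fin N → V C
  copyVert r = G.n ↑ʳ r

  -- π maps the copy H_w onto w and fixes V(G); depth is the distance to V(G).
  π : V C → V G
  π z = [ id , base G H ]′ (splitAt G.n z)

  depth : V C → ℕ
  depth z = [ const 0 , const 1 ]′ (splitAt G.n z)

  π-gVert : ∀ g → π (gVert G H g) ≡ g
  π-gVert g = cong [ id , base G H ]′ (splitAt-↑ˡ G.n g N)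

  depth-gVert : ∀ g → depth (gVert G H g) ≡ 0
  depth-gVert g = cong [ const 0 , const 1 ]′ (splitAt-↑ˡ G.n g N)

  π-copyVert : ∀ r → π (copyVert r) ≡ base G H r
  π-copyVert r = cong [ id , base G H ]′ (splitAt-↑ʳ G.n N r)

  depth-copyVert : ∀ r → depth (copyVert r) ≡ 1
  depth-copyVert r = cong [ const 0 , const 1 ]′ (splitAt-↑ʳ G.n N r)

  depth≡0⊎1 : ∀ z → depth z ≡ 0 ⊎ depth z ≡ 1
  depth≡0⊎1 z with splitAt G.n z
  ... | inj₁ _ = inj₁ refl
  ... | inj₂ _ = inj₂ refl

  depth≤1 : ∀ z → depth z ≤ 1
  depth≤1 z with splitAt G.n z
  ... | inj₁ _ = z≤n
  ... | inj₂ _ = ≤-refl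

  gVert-π : ∀ z → depth z ≡ 0 → gVert G H (π z) ≡ z
  gVert-π z with splitAt G.n z in eq
  ... | inj₁ _ = λ _ → splitAt⁻¹-↑ˡ eq
  ... | inj₂ _ = λ ()

  adj-gVert-π : ∀ z → depth z ≡ 1 → C.Adj z (gVert G H (π z))
  adj-gVert-π z with splitAt G.n z
  ... | inj₁ _ = λ ()
  ... | inj₂ r = λ _ → subst (CAdj G H (inj₂ r)) (sym (splitAt-↑ˡ G.n (base G H r) N)) refl

  Step : V C → V C → Set
  Step a c = (depth a ≡ 0 × depth c ≡ 0 × G.Adj (π a) (π c)) ⊎ π a ≡ π c

  pattern horizontal da dc e = inj₁ (da , dc , e)
  pattern vertical πa≡πc = inj₂ πa≡πc

  step : C.Adj a c → Step a c
  step {a} {c} e with splitAt G.n a | splitAt G.n c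
  ... | inj₁ _ | inj₁ _ = horizontal refl refl e
  ... | inj₁ _ | inj₂ _ = vertical (sym e)
  ... | inj₂ _ | inj₁ _ = vertical e
  ... | inj₂ _ | inj₂ _ = vertical (proj₁ e)

  SameCopy : V C → V C → Set
  SameCopy a b = depth a ≡ 1 × depth b ≡ 1 × π a ≡ π b

  sameCopy? : ∀ a b → Dec (SameCopy a b)
  sameCopy? a b = (depth a ℕ.≟ 1) ×-dec (depth b ℕ.≟ 1) ×-dec (π a Fin.≟ π b)

  lift : {S : V G → Set} {T : V C → Set} {u v : V G} → (∀ y → S y → T (gVert G H y)) →
         WalkIn G S u v k → WalkIn C T (gVert G H u) (gVert G H v) k
  lift S⇒T (nil {u} , su) = nil , S⇒T u su
  lift S⇒T (cons {u} {w} e q , su , oq) =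
    let (q′ , oq′) = lift S⇒T (q , oq)
    in cons (subst₂ (CAdj G H) (sym (splitAt-↑ˡ G.n u N)) (sym (splitAt-↑ˡ G.n w N)) e) q′ , S⇒T u su , oq′

  ascend : {T : V C → Set} → ∀ a → T a → T (gVert G H (π a)) → WalkIn C T a (gVert G H (π a)) (depth a)
  ascend {T} a ta tπa with depth≡0⊎1 a
  ... | inj₁ d≡0 = subst₂ (λ z d → WalkIn C T z (gVert G H (π a)) d) (gVert-π a d≡0) (sym d≡0) (nil , tπa)
  ... | inj₂ d≡1 = subst (WalkIn C T a (gVert G H (π a))) (sym d≡1) (cons (adj-gVert-π a d≡1) nil , ta , tπa)

  descend : {T : V C → Set} → ∀ b → T (gVert G H (π b)) → T b → WalkIn C T (gVert G H (π b)) b (depth b)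
  descend b tπb tb = reverse (ascend b tb tπb)

  embed : {S : V G → Set} {T : V C → Set} → T a → T b → (∀ y → S y → T (gVert G H y)) →
          WalkIn G S (π a) (π b) j → WalkIn C T a b (depth a ℕ.+ (j ℕ.+ depth b))
  embed {a} {b} ta tb S⇒T (q , oq) =
    ascend a ta (S⇒T _ (OnWalk-first q oq)) ++ᴾ (lift S⇒T (q , oq) ++ᴾ descend b (S⇒T _ (OnWalk-last q oq)) tb)

  embedWalk : Walk G (π a) (π b) j → Walk C a b (depth a ℕ.+ (j ℕ.+ depth b))
  embedWalk q = proj₁ (embed {T = λ _ → Unit} tt tt (λ _ _ → tt) (q , OnWalk-Unit q))

  Shadow : (V C → Set) → V C → V C → V G → Set
  Shadow T a b y = y ≡ π a ⊎ y ≡ π b ⊎ T (gVert G H y)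

  record Projection (T : V C → Set) (a b : V C) (k : ℕ) : Set where
    constructor projection
    field
      {len}   : ℕ
      walk    : WalkIn G (Shadow T a b) (π a) (π b) len
      shorter : depth a ℕ.+ (len ℕ.+ depth b) ≤ k

  -- Vertical steps are dropped.  Leaving a copy of H, or entering one, costs a vertical step, and these
  -- steps are distinct unless both ends lie in the same copy.
  project : {T : V C → Set} → ¬ SameCopy a b → (p : Walk C a b k) → OnWalk C T p → Projection T a b k
  project {a} ¬same nil _ with depth≡0⊎1 a
  ... | inj₁ d≡0 = projection (nil , inj₁ refl) (subst (λ d → d ℕ.+ (0 ℕ.+ d) ≤ 0) (sym d≡0) z≤n)
  ... | inj₂ d≡1 = ⊥-elim (¬same (d≡1 , d≡1 , refl))
  project {a} {b} {T = T} ¬same (cons {w = c} {k = k} e p) (_ , op) with step e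
  ... | horizontal da dc e′ = prepend (project (λ (dc≡1 , _) → 0≢1+n (trans (sym dc) dc≡1)) p op)
    where
    fromC : ∀ y → Shadow T c b y → Shadow T a b y
    fromC y (inj₁ refl) = inj₂ (inj₂ (subst T (sym (gVert-π c dc)) (OnWalk-first p op)))
    fromC y (inj₂ rest) = inj₂ rest
    prepend : Projection T c b k → Projection T a b (suc k)
    prepend (projection {len} (q , oq) short) =
      projection (cons e′ q , inj₁ refl , OnWalk-map fromC q oq)
                 (subst (λ d → d ℕ.+ (suc len ℕ.+ depth b) ≤ suc k) (sym da)
                        (s≤s (subst (λ d → d ℕ.+ (len ℕ.+ depth b) ≤ k) dc short)))
  ... | vertical πa≡πc with sameCopy? c b
  ...   | yes (dc , db , πc≡πb) =
    projection (subst (λ u → WalkIn G (Shadow T a b) u (π b) 0) (sym (trans πa≡πc πc≡πb)) (nil , inj₂ (inj₁ refl)))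
               (subst₂ (λ d d′ → d ℕ.+ (0 ℕ.+ d′) ≤ suc k) (sym da) (sym db) (s≤s z≤n))
    where
    da : depth a ≡ 0
    da with depth≡0⊎1 a
    ... | inj₁ da≡0 = da≡0
    ... | inj₂ da≡1 = ⊥-elim (¬same (da≡1 , db , trans πa≡πc πc≡πb))
  ...   | no ¬sameCB = retarget (project ¬sameCB p op)
    where
    fromC : ∀ y → Shadow T c b y → Shadow T a b y
    fromC y (inj₁ y≡πc) = inj₁ (trans y≡πc (sym πa≡πc))
    fromC y (inj₂ rest) = inj₂ rest
    retarget : Projection T c b k → Projection T a b (suc k)
    retarget (projection {len} (q , oq) short) =
      projection (subst (λ u → WalkIn G (Shadow T a b) u (π b) len) (sym πa≡πc) (q , OnWalk-map fromC q oq))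
                 (≤-trans (+-monoˡ-≤ (len ℕ.+ depth b) (depth≤1 a)) (s≤s (≤-trans (m≤n+m _ (depth c)) short)))

  module _ {A : Subset G.n} {B : Subset N} where

    gVert-∈⁺ : ∀ {g} → g ∈ A → gVert G H g ∈ A ++ᵛ B
    gVert-∈⁺ {g} g∈A = lookup⇒∈ (trans (lookup-++ˡ A B g) ([]=⇒lookup g∈A))

    gVert-∈⁻ : ∀ {g} → gVert G H g ∈ A ++ᵛ B → g ∈ A
    gVert-∈⁻ {g} g∈ = lookup⇒∈ (trans (sym (lookup-++ˡ A B g)) ([]=⇒lookup g∈))

    copyVert-∈⁺ : ∀ {r} → r ∈ B → copyVert r ∈ A ++ᵛ B
    copyVert-∈⁺ {r} r∈B = lookup⇒∈ (trans (lookup-++ʳ A B r) ([]=⇒lookup r∈B))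

    copyVert-∈⁻ : ∀ {r} → copyVert r ∈ A ++ᵛ B → r ∈ B
    copyVert-∈⁻ {r} r∈ = lookup⇒∈ (trans (sym (lookup-++ʳ A B r)) ([]=⇒lookup r∈))

    ∈-++⁻ : ∀ {z} → z ∈ A ++ᵛ B → (∃[ g ] g ∈ A × gVert G H g ≡ z) ⊎ (∃[ r ] r ∈ B × copyVert r ≡ z)
    ∈-++⁻ {z} z∈ with splitAt G.n z in eq | trans (sym (lookup-splitAt G.n A B z)) ([]=⇒lookup z∈)
    ... | inj₁ g | g∈A = inj₁ (g , lookup⇒∈ g∈A , splitAt⁻¹-↑ˡ eq)
    ... | inj₂ r | r∈B = inj₂ (r , lookup⇒∈ r∈B , splitAt⁻¹-↑ʳ eq)

    π-∈ : ∀ {z} → z ∈ A ++ᵛ B → (depth z ≡ 0 × π z ∈ A) ⊎ (depth z ≡ 1 × π z ∈ image (base G H) B)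
    π-∈ {z} z∈ with splitAt G.n z | trans (sym (lookup-splitAt G.n A B z)) ([]=⇒lookup z∈)
    ... | inj₁ g | g∈A = inj₁ (refl , lookup⇒∈ g∈A)
    ... | inj₂ r | r∈B = inj₂ (refl , ∈-image⁺ (base G H) (lookup⇒∈ r∈B))

  module _ (A : Subset G.n) (B : Subset N) where
    private
      X = A ++ᵛ B

    visible-project : ¬ SameCopy a b → Visible C X a b → Visible G A (π a) (π b)
    visible-project {a} {b} ¬same (k , p , shortest , op) with project ¬same p op
    ... | projection {len} (q , oq) short = len , q , noShorter , OnWalk-map inA q oq
      where
      noShorter : NoShorter G (π a) (π b) len
      noShorter j j<len q′ =
        shortest _ (<-≤-trans (+-monoʳ-< (depth a) (+-monoˡ-< (depth b) j<len)) short) (embedWalk q′)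
      πgVert : ∀ {y z} → gVert G H y ≡ z → y ≡ π z
      πgVert {y} refl = sym (π-gVert y)
      inA : ∀ y → Shadow (λ z → z ∈ X → z ≡ a ⊎ z ≡ b) a b y → y ∈ A → y ≡ π a ⊎ y ≡ π b
      inA y (inj₁ y≡πa) _ = inj₁ y≡πa
      inA y (inj₂ (inj₁ y≡πb)) _ = inj₂ y≡πb
      inA y (inj₂ (inj₂ between)) y∈A = Sum.map πgVert πgVert (between (gVert-∈⁺ y∈A))

    visible-embed : ¬ SameCopy a b → (depth a ≡ 1 → π a ∉ A) → (depth b ≡ 1 → π b ∉ A) →
                    Visible G A (π a) (π b) → Visible C X a b
    visible-embed {a} {b} ¬same a-out b-out (j , q , shortest , oq) =
      let (p , op) = embed (λ _ → inj₁ refl) (λ _ → inj₂ refl) inC (q , oq)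
      in depth a ℕ.+ (j ℕ.+ depth b) , p , noShorter , op
      where
      noShorter : NoShorter C a b (depth a ℕ.+ (j ℕ.+ depth b))
      noShorter k k< p′ with project {T = λ _ → Unit} ¬same p′ (OnWalk-Unit p′)
      ... | projection {len} (q′ , _) short =
        shortest len (+-cancelʳ-< (depth b) len j (+-cancelˡ-< (depth a) _ _ (≤-<-trans short k<))) q′
      endpoint : ∀ {y z} → (depth z ≡ 1 → π z ∉ A) → y ∈ A → y ≡ π z → gVert G H y ≡ z
      endpoint {z = z} z-out y∈A refl with depth≡0⊎1 z
      ... | inj₁ d≡0 = gVert-π z d≡0
      ... | inj₂ d≡1 = ⊥-elim (z-out d≡1 y∈A)
      inC : ∀ y → (y ∈ A → y ≡ π a ⊎ y ≡ π b) → gVert G H y ∈ X → gVert G H y ≡ a ⊎ gVert G H y ≡ b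
      inC y between gy∈X =
        let y∈A = gVert-∈⁻ gy∈X in Sum.map (endpoint a-out y∈A) (endpoint b-out y∈A) (between y∈A)

    π∉A : image (base G H) B ⊆ ∁ A → ∀ {z} → z ∈ X → depth z ≡ 1 → π z ∉ A
    π∉A image⊆∁A z∈X d≡1 with π-∈ z∈X
    ... | inj₁ (d≡0 , _) = λ _ → 0≢1+n (trans (sym d≡0) d≡1)
    ... | inj₂ (_ , πz∈image) = x∈∁p⇒x∉p (image⊆∁A πz∈image)

    π-∈-∪ : ∀ {z} → z ∈ X → π z ∈ A ∪ image (base G H) B
    π-∈-∪ z∈X with π-∈ z∈X
    ... | inj₁ (_ , πz∈A) = p⊆p∪q _ πz∈A
    ... | inj₂ (_ , πz∈image) = q⊆p∪q A _ πz∈image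

    absCVisible⇒mutualVisibility : AbsCVisible G A (image (base G H) B) → MutualVisibilitySet C X
    absCVisible⇒mutualVisibility abs@((image⊆∁A , _) , _) z z′ z∈X z′∈X with sameCopy? z z′
    ... | no ¬same = visible-embed ¬same (π∉A image⊆∁A z∈X) (π∉A image⊆∁A z′∈X)
                       (absCVisible⇒visibleSet-∪ abs (π z) (π z′) (π-∈-∪ z∈X) (π-∈-∪ z′∈X))
    ... | yes (dz , dz′ , πz≡πz′) with z Fin.≟ z′
    ...   | yes refl = visible-refl X z
    ...   | no z≢z′ = visible-via-common-neighbour z≢z′ (π∉A image⊆∁A z∈X dz ∘ gVert-∈⁻) (adj-gVert-π z dz)
                        (subst (λ y → C.Adj (gVert G H y) z′) (sym πz≡πz′) (C.sym (adj-gVert-π z′ dz′)))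

    mutualVisibility⇒absCVisible : image (base G H) B ⊆ ∁ A → MutualVisibilitySet C X →
                                   AbsCVisible G A (image (base G H) B)
    mutualVisibility⇒absCVisible image⊆∁A mv = (image⊆∁A , visImage , visA-image) , visA
      where
      notSameCopy-gVert : ∀ {g b} → ¬ SameCopy (gVert G H g) b
      notSameCopy-gVert {g} (d≡1 , _) = 0≢1+n (trans (sym (depth-gVert g)) d≡1)
      visA : MutualVisibilitySet G A
      visA q q′ q∈A q′∈A = subst₂ (Visible G A) (π-gVert q) (π-gVert q′)
        (visible-project notSameCopy-gVert (mv (gVert G H q) (gVert G H q′) (gVert-∈⁺ q∈A) (gVert-∈⁺ q′∈A)))
      visA-image : ∀ u w → u ∈ A → w ∈ image (base G H) B → Visible G A u w
      visA-image u w u∈A w∈image with ∈-image⁻ (base G H) w∈image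
      ... | r , r∈B , refl = subst₂ (Visible G A) (π-gVert u) (π-copyVert r)
        (visible-project notSameCopy-gVert (mv (gVert G H u) (copyVert r) (gVert-∈⁺ u∈A) (copyVert-∈⁺ r∈B)))
      visImage : VisibleSet G A (image (base G H) B)
      visImage w w′ w∈ w′∈ with ∈-image⁻ (base G H) w∈ | ∈-image⁻ (base G H) w′∈
      ... | r , r∈B , refl | r′ , r′∈B , refl with base G H r Fin.≟ base G H r′
      ...   | yes br≡br′ = subst (Visible G A (base G H r)) br≡br′ (visible-refl A (base G H r))
      ...   | no br≢br′ = subst₂ (Visible G A) (π-copyVert r) (π-copyVert r′)
        (visible-project (λ (_ , _ , πr≡πr′) → br≢br′ (trans (sym (π-copyVert r)) (trans πr≡πr′ (π-copyVert r′))))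
                         (mv (copyVert r) (copyVert r′) (copyVert-∈⁺ r∈B) (copyVert-∈⁺ r′∈B)))

  embedG≡ : (Q : Subset G.n) → embedG G H Q ≡ Q ++ᵛ ⊥
  embedG≡ Q = trans (sym (tabulate∘lookup _)) (trans (tabulate-cong pointwise) (tabulate∘lookup _))
    where
    lookup-tabulate : ∀ {f} (v : Subset (G.n ℕ.+ N)) z → v ≡ tabulate f → lookup v z ≡ f z
    lookup-tabulate v z refl = lookup∘tabulate _ z
    pointwise : ∀ z → lookup (embedG G H Q) z ≡ lookup (Q ++ᵛ ⊥) z
    pointwise z with splitAt G.n z | lookup-tabulate (embedG G H Q) z refl | lookup-splitAt G.n Q ⊥ z
    ... | inj₁ g | e | e′ = trans e (sym e′)
    ... | inj₂ r | e | e′ = trans e (trans (sym (lookup-replicate r outside)) (sym e′))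

  embedG-∪ : (Q : Subset G.n) (T : Subset N) → embedG G H Q ∪ (⊥ ++ᵛ T) ≡ Q ++ᵛ T
  embedG-∪ Q T = begin
    embedG G H Q ∪ (⊥ ++ᵛ T)  ≡⟨ cong (_∪ (⊥ ++ᵛ T)) (embedG≡ Q) ⟩
    (Q ++ᵛ ⊥) ∪ (⊥ ++ᵛ T)     ≡⟨ zipWith-++ _∨_ Q ⊥ ⊥ T ⟩
    (Q ∪ ⊥) ++ᵛ (⊥ ∪ T)       ≡⟨ cong₂ _++ᵛ_ (∪-identityʳ Q) (∪-identityˡ T) ⟩
    Q ++ᵛ T                   ∎
    where open ≡-Reasoning

  base-hVert : ∀ {r w h} → copyVert r ≡ hVert G H w h → base G H r ≡ w
  base-hVert {w = w} {h} e rewrite ↑ʳ-injective G.n _ _ e = cong proj₁ (remQuot-combine w h)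

  coronaForm⇒ : ∀ {A B} → CoronaForm G H (A ++ᵛ B) → Nonempty A × A ⊂ ⊤ × Nonempty B × image (base G H) B ⊆ ∁ A
  coronaForm⇒ {A} {B} (Q , T , neQ , Q⊂⊤ , (z , z∈T) , T⊆copies , A++B≡) with Vec.splitAt G.n T
  ... | T₁ , T₂ , refl with Empty-unique noGroundVertex
    where
    noGroundVertex : Empty T₁
    noGroundVertex (g , g∈T₁) with T⊆copies (gVert G H g) (gVert-∈⁺ g∈T₁)
    ... | _ , _ , _ , e = 0≢1+n (trans (sym (depth-gVert g)) (trans (cong depth e) (depth-copyVert _)))
  ... | refl with ++-injective A Q (trans A++B≡ (embedG-∪ Q T₂))
  ... | refl , refl = neQ , Q⊂⊤ , nonemptyB , image⊆∁A
    where
    nonemptyB : Nonempty B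
    nonemptyB with T⊆copies z z∈T
    ... | w , h , _ , refl = combine w h , copyVert-∈⁻ z∈T
    image⊆∁A : image (base G H) B ⊆ ∁ A
    image⊆∁A w∈ with ∈-image⁻ (base G H) w∈
    ... | r , r∈B , refl with T⊆copies (copyVert r) (copyVert-∈⁺ r∈B)
    ...   | w , h , w∉A , e = x∉p⇒x∈∁p (subst (_∉ A) (sym (base-hVert e)) w∉A)

  coronaForm⇐ : ∀ {A B} → Nonempty A → A ⊂ ⊤ → Nonempty B → image (base G H) B ⊆ ∁ A → CoronaForm G H (A ++ᵛ B)
  coronaForm⇐ {A} {B} neA A⊂⊤ (r , r∈B) image⊆∁A =
    A , ⊥ ++ᵛ B , neA , A⊂⊤ , (copyVert r , copyVert-∈⁺ r∈B) , inCopies , sym (embedG-∪ A B)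
    where
    inCopies : ∀ z → z ∈ ⊥ ++ᵛ B → ∃[ w ] ∃[ h ] w ∉ A × z ≡ hVert G H w h
    inCopies z z∈ with ∈-++⁻ z∈
    ... | inj₁ (g , g∈⊥ , _) = ⊥-elim (∉⊥ g∈⊥)
    ... | inj₂ (r , r∈B , refl) =
      base G H r , fib G H r , x∈∁p⇒x∉p (image⊆∁A (∈-image⁺ (base G H) r∈B)) ,
      cong (G.n ↑ʳ_) (sym (combine-remQuot {G.n} H.n r))

module Counting (G H : Graph) (cG : Connected G) (x : ℤ) where
  private
    module G = Graph G
    module H = Graph H
    N = G.n ℕ.* H.n
    C = corona G H
  open CoronaGeometry G H
  open PowerSums x

  admissible? : (A : Subset G.n) → Dec (Nonempty A × A ⊂ ⊤ × MutualVisibilitySet G A)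
  admissible? A = nonempty? A ×-dec A ⊂? ⊤ ×-dec mutualVisibilitySet? G cG A

  counted? : (S : VSet C) → Dec (MutualVisibilitySet C S × CoronaForm G H S)
  counted? S = mutualVisibilitySet? C (corona-connected G H cG) S ×-dec coronaForm? G H S

  extends? : (A : Subset G.n) (B : Subset N) → Dec (Nonempty B × AbsCVisible G A (image (base G H) B))
  extends? A B = nonempty? B ×-dec absCVisible? G cG A (image (base G H) B)

  counted⇔ : (A : Subset G.n) (B : Subset N) →
             (MutualVisibilitySet C (A ++ᵛ B) × CoronaForm G H (A ++ᵛ B)) ⇔
             ((Nonempty A × A ⊂ ⊤ × MutualVisibilitySet G A) × (Nonempty B × AbsCVisible G A (image (base G H) B)))
  counted⇔ A B = mk⇔ to from
    where
    to : MutualVisibilitySet C (A ++ᵛ B) × CoronaForm G H (A ++ᵛ B) →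
         (Nonempty A × A ⊂ ⊤ × MutualVisibilitySet G A) × (Nonempty B × AbsCVisible G A (image (base G H) B))
    to (mv , cf) with coronaForm⇒ cf
    ... | neA , A⊂⊤ , neB , image⊆∁A =
      let abs = mutualVisibility⇒absCVisible A B image⊆∁A mv in (neA , A⊂⊤ , proj₂ abs) , (neB , abs)
    from : (Nonempty A × A ⊂ ⊤ × MutualVisibilitySet G A) × (Nonempty B × AbsCVisible G A (image (base G H) B)) →
           MutualVisibilitySet C (A ++ᵛ B) × CoronaForm G H (A ++ᵛ B)
    from ((neA , A⊂⊤ , _) , (neB , abs)) =
      absCVisible⇒mutualVisibility A B abs , coronaForm⇐ neA A⊂⊤ neB (proj₁ (proj₁ abs))

  extensions : Subset G.n → ℤ
  extensions A = ∑[ B ∈ allSubsets N ] when (extends? A B) (x ^ ∣ B ∣)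

  lhsSum≡ : lhsSum G H cG x ≡ ∑[ A ∈ allSubsets G.n ] when (admissible? A) (x ^ ∣ A ∣ * extensions A)
  lhsSum≡ = begin
    lhsSum G H cG x                                                ≡⟨ ∑-filter counted? (allSubsets (G.n ℕ.+ N)) _ ⟩
    ∑[ S ∈ allSubsets (G.n ℕ.+ N) ] when (counted? S) (x ^ ∣ S ∣)   ≡⟨ ∑-allSubsets-++ G.n N _ ⟩
    ∑[ A ∈ allSubsets G.n ] ∑[ B ∈ allSubsets N ] when (counted? (A ++ᵛ B)) (x ^ ∣ A ++ᵛ B ∣)
      ≡⟨ ∑-cong (allSubsets G.n) (λ A → ∑-cong (allSubsets N) (split A)) ⟩
    ∑[ A ∈ allSubsets G.n ] ∑[ B ∈ allSubsets N ] when (admissible? A) (x ^ ∣ A ∣ * when (extends? A B) (x ^ ∣ B ∣))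
      ≡⟨ ∑-cong (allSubsets G.n) (λ A → ∑-when (admissible? A) (allSubsets N) (x ^ ∣ A ∣) _) ⟩
    ∑[ A ∈ allSubsets G.n ] when (admissible? A) (x ^ ∣ A ∣ * extensions A) ∎
    where
    open ≡-Reasoning
    split : ∀ A B → when (counted? (A ++ᵛ B)) (x ^ ∣ A ++ᵛ B ∣)
                  ≡ when (admissible? A) (x ^ ∣ A ∣ * when (extends? A B) (x ^ ∣ B ∣))
    split A B = trans (when-cong (counted? (A ++ᵛ B)) (admissible? A ×-dec extends? A B) (counted⇔ A B)
                                 (λ _ → trans (cong (x ^_) (∣++∣ A B)) (^-distribˡ-+-* x ∣ A ∣ ∣ B ∣)))
                      (when-×-dec (admissible? A) (extends? A B) (x ^ ∣ A ∣) (x ^ ∣ B ∣))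

  Γ-unique : ∀ A → Unique (Γ G H cG x A)
  Γ-unique A = Unique.filter⁺ (maxAbsCVisible? G cG A) (allSubsets-unique G.n)

  ∈Γ⇒maximal : ∀ {A Ω} → Ω ∈ₗ Γ G H cG x A → MaxAbsCVisible G A Ω
  ∈Γ⇒maximal {A} {Ω} Ω∈Γ = proj₂ (∈-filter⁻ (maxAbsCVisible? G cG A) {v = Ω} {xs = allSubsets G.n} Ω∈Γ)

  -- let rather than with: with-abstraction normalises the goal, and Γ unfolds into the decision procedures.
  absCVisible⇔⊆maximal : ∀ A W → AbsCVisible G A W ⇔ Any (W ⊆_) (Γ G H cG x A)
  absCVisible⇔⊆maximal A W = mk⇔ to from
    where
    to : AbsCVisible G A W → Any (W ⊆_) (Γ G H cG x A)
    to abs =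
      let (Ω , maxΩ , W⊆Ω) = extend-to-maximal (absCVisible? G cG A) abs
      in lose {P = W ⊆_} (∈-filter⁺ (maxAbsCVisible? G cG A) {x = Ω} {xs = allSubsets G.n} (∈-allSubsets Ω) maxΩ) W⊆Ω
    from : Any (W ⊆_) (Γ G H cG x A) → AbsCVisible G A W
    from W⊆someΩ =
      let (Ω , Ω∈Γ , W⊆Ω) = find W⊆someΩ
      in absCVisible-⊆ W⊆Ω (proj₁ (∈Γ⇒maximal Ω∈Γ))

  weight : Subset N → ℤ
  weight B = when (nonempty? B) (x ^ ∣ B ∣)

  copyPoly : Subset G.n → ℤ
  copyPoly U = (1ℤ + x) ^ (∣ U ∣ ℕ.* H.n) - 1ℤ

  baseImage⊆? : (B : Subset N) (U : Subset G.n) → Dec (image (base G H) B ⊆ U)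
  baseImage⊆? B U = image (base G H) B ⊆? U

  extensions≡any : ∀ A → extensions A ≡ ∑[ B ∈ allSubsets N ] (weight B * 𝟙 (any? (baseImage⊆? B) (Γ G H cG x A)))
  extensions≡any A = ∑-cong (allSubsets N) λ B →
    trans (when-cong (extends? A B) (nonempty? B ×-dec any? (baseImage⊆? B) (Γ G H cG x A))
                     (mk⇔ (λ (ne , abs) → ne , Equivalence.to (absCVisible⇔⊆maximal A _) abs)
                          (λ (ne , any) → ne , Equivalence.from (absCVisible⇔⊆maximal A _) any))
                     (λ _ → refl))
          (when-×-dec-𝟙 (nonempty? B) (any? (baseImage⊆? B) (Γ G H cG x A)) (x ^ ∣ B ∣))

  ∑-weight-image⊆ : ∀ U → ∑[ B ∈ allSubsets N ] (weight B * 𝟙 (baseImage⊆? B U)) ≡ copyPoly U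
  ∑-weight-image⊆ U = begin
    ∑[ B ∈ allSubsets N ] (weight B * 𝟙 (baseImage⊆? B U))
      ≡⟨ ∑-cong (allSubsets N) (λ B → sym (when-×-dec-𝟙 (nonempty? B) (baseImage⊆? B U) (x ^ ∣ B ∣))) ⟩
    ∑[ B ∈ allSubsets N ] when (nonempty? B ×-dec baseImage⊆? B U) (x ^ ∣ B ∣)
      ≡⟨ ∑-cong (allSubsets N) (λ B → when-cong (nonempty? B ×-dec baseImage⊆? B U) (nonempty? B ×-dec B ⊆? U′)
                                                (mk⇔ (map₂ (image⊆⇒⊆preimage (base G H)))
                                                     (map₂ (⊆preimage⇒image⊆ (base G H))))
                                                (λ _ → refl)) ⟩
    ∑[ B ∈ allSubsets N ] when (nonempty? B ×-dec B ⊆? U′) (x ^ ∣ B ∣)  ≡⟨ ∑-powers-nonempty-⊆ U′ ⟩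
    (1ℤ + x) ^ ∣ U′ ∣ - 1ℤ                                             ≡⟨ cong (λ k → (1ℤ + x) ^ k - 1ℤ) ∣U′∣ ⟩
    copyPoly U                                                         ∎
    where
    open ≡-Reasoning
    U′ = preimage (base G H) U
    ∣U′∣ : ∣ U′ ∣ ≡ ∣ U ∣ ℕ.* H.n
    ∣U′∣ = ∣preimage-remQuot∣ H.n U

  extensions-inclusion–exclusion : ∀ A →
    extensions A ≡ ∑[ J ∈ nonemptySublists (Γ G H cG x A) ] (sign J * copyPoly (⋂ J))
  extensions-inclusion–exclusion A = begin
    extensions A                                                        ≡⟨ extensions≡any A ⟩
    ∑[ B ∈ allSubsets N ] (weight B * 𝟙 (any? (baseImage⊆? B) ΓA))
      ≡⟨ ∑-cong (allSubsets N) (λ B → cong (weight B *_) (𝟙-any-inclusion–exclusion (baseImage⊆? B) ΓA)) ⟩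
    ∑[ B ∈ allSubsets N ] (weight B * ∑[ J ∈ Js ] (sign J * 𝟙 (all? (baseImage⊆? B) J)))
      ≡⟨ ∑-cong (allSubsets N) (λ B → trans (*-distribˡ-∑ (weight B) Js _)
                                             (∑-cong Js (λ J → reassoc (weight B) (sign J) _))) ⟩
    ∑[ B ∈ allSubsets N ] ∑[ J ∈ Js ] (sign J * (weight B * 𝟙 (all? (baseImage⊆? B) J)))
      ≡⟨ ∑-comm (allSubsets N) Js _ ⟩
    ∑[ J ∈ Js ] ∑[ B ∈ allSubsets N ] (sign J * (weight B * 𝟙 (all? (baseImage⊆? B) J)))
      ≡⟨ ∑-cong Js (λ J → sym (*-distribˡ-∑ (sign J) (allSubsets N) _)) ⟩
    ∑[ J ∈ Js ] (sign J * ∑[ B ∈ allSubsets N ] (weight B * 𝟙 (all? (baseImage⊆? B) J)))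
      ≡⟨ ∑-cong Js (λ J → cong (sign J *_) (trans (∑-cong (allSubsets N) (λ B → cong (weight B *_) (all≡⋂ B J)))
                                                  (∑-weight-image⊆ (⋂ J)))) ⟩
    ∑[ J ∈ Js ] (sign J * copyPoly (⋂ J))                               ∎
    where
    open ≡-Reasoning
    ΓA = Γ G H cG x A
    Js = nonemptySublists ΓA
    reassoc : ∀ w s i → w * (s * i) ≡ s * (w * i)
    reassoc = solve-∀
    all≡⋂ : ∀ B J → 𝟙 (all? (baseImage⊆? B) J) ≡ 𝟙 (baseImage⊆? B (⋂ J))
    all≡⋂ B J = when-cong (all? (baseImage⊆? B) J) (baseImage⊆? B (⋂ J)) (mk⇔ (⊆-⋂⁺ J) (⊆-⋂⁻ J)) (λ _ → refl)

  extensions-disjoint : ∀ A → DisjointVisible G A → extensions A ≡ ∑[ Ω ∈ Γ G H cG x A ] copyPoly Ω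
  extensions-disjoint A disjoint = begin
    extensions A                                                        ≡⟨ extensions≡any A ⟩
    ∑[ B ∈ allSubsets N ] (weight B * 𝟙 (any? (baseImage⊆? B) ΓA))      ≡⟨ ∑-cong (allSubsets N) spread ⟩
    ∑[ B ∈ allSubsets N ] ∑[ Ω ∈ ΓA ] (weight B * 𝟙 (baseImage⊆? B Ω))  ≡⟨ ∑-comm (allSubsets N) ΓA _ ⟩
    ∑[ Ω ∈ ΓA ] ∑[ B ∈ allSubsets N ] (weight B * 𝟙 (baseImage⊆? B Ω))  ≡⟨ ∑-cong ΓA ∑-weight-image⊆ ⟩
    ∑[ Ω ∈ ΓA ] copyPoly Ω                                              ∎
    where
    open ≡-Reasoning
    ΓA = Γ G H cG x A
    atMostOne : ∀ B → Nonempty B → ∀ {Ω Ω′} → Ω ∈ₗ ΓA → Ω′ ∈ₗ ΓA →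
                image (base G H) B ⊆ Ω → image (base G H) B ⊆ Ω′ → Ω ≡ Ω′
    atMostOne B (r , r∈B) {Ω} {Ω′} Ω∈Γ Ω′∈Γ B⊆Ω B⊆Ω′ = decidable-stable (Ω ≟ˢ Ω′) λ Ω≢Ω′ →
      disjoint Ω Ω′ (∈Γ⇒maximal Ω∈Γ) (∈Γ⇒maximal Ω′∈Γ) Ω≢Ω′ (base G H r , x∈p∩q⁺ (B⊆Ω br∈ , B⊆Ω′ br∈))
      where br∈ = ∈-image⁺ (base G H) r∈B
    spread : ∀ B → weight B * 𝟙 (any? (baseImage⊆? B) ΓA) ≡ ∑[ Ω ∈ ΓA ] (weight B * 𝟙 (baseImage⊆? B Ω))
    spread B = trans (when-*-cong (nonempty? B) (𝟙-any-atMostOne (baseImage⊆? B) ΓA (Γ-unique A) ∘ atMostOne B))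
                     (*-distribˡ-∑ (weight B) ΓA _)

  p≡extensions : ∀ A → p G H cG x A ≡ x ^ ∣ A ∣ * extensions A
  p≡extensions A = if-does (disjointVisible? G cG A)
    (λ disjoint → begin
      ∑[ Ω ∈ ΓA ] (copyPoly Ω * x ^ ∣ A ∣)   ≡⟨ ∑-cong ΓA (λ Ω → *-comm (copyPoly Ω) _) ⟩
      ∑[ Ω ∈ ΓA ] (x ^ ∣ A ∣ * copyPoly Ω)   ≡⟨ sym (*-distribˡ-∑ (x ^ ∣ A ∣) ΓA copyPoly) ⟩
      x ^ ∣ A ∣ * ∑[ Ω ∈ ΓA ] copyPoly Ω     ≡⟨ cong (x ^ ∣ A ∣ *_) (sym (extensions-disjoint A disjoint)) ⟩
      x ^ ∣ A ∣ * extensions A               ∎)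
    (λ _ → begin
      ∑[ J ∈ Js ] (sign J * (copyPoly (⋂ J) * x ^ ∣ A ∣))  ≡⟨ ∑-cong Js (λ J → reassoc (sign J) (copyPoly (⋂ J)) _) ⟩
      ∑[ J ∈ Js ] (x ^ ∣ A ∣ * (sign J * copyPoly (⋂ J)))  ≡⟨ sym (*-distribˡ-∑ (x ^ ∣ A ∣) Js _) ⟩
      x ^ ∣ A ∣ * ∑[ J ∈ Js ] (sign J * copyPoly (⋂ J))
        ≡⟨ cong (x ^ ∣ A ∣ *_) (sym (extensions-inclusion–exclusion A)) ⟩
      x ^ ∣ A ∣ * extensions A                             ∎)
    where
    open ≡-Reasoning
    ΓA = Γ G H cG x A
    Js = nonemptySublists ΓA
    reassoc : ∀ s e y → s * (e * y) ≡ y * (s * e)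
    reassoc = solve-∀

mainTheorem18 : (G H : Graph) (cG : Connected G) (cH : Connected H) (x : ℤ) →
    lhsSum G H cG x ≡ rhsSum G H cG x
mainTheorem18 G H cG _ x = begin
  lhsSum G H cG x                                               ≡⟨ lhsSum≡ ⟩
  ∑[ A ∈ Qs ] when (admissible? A) (x ^ ∣ A ∣ * extensions A)
    ≡⟨ ∑-cong Qs (λ A → cong (when (admissible? A)) (sym (p≡extensions A))) ⟩
  ∑[ A ∈ Qs ] when (admissible? A) (p G H cG x A)              ≡⟨ sym (∑-filter admissible? Qs (p G H cG x)) ⟩
  rhsSum G H cG x                                               ∎
  where
  open ≡-Reasoning
  open Counting G H cG x
  Qs = allSubsets (Graph.n G)
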